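{- Let $n\ge 3$. For every $-1\le i\le\lfloor\frac{n-1}{2}\rfloor-1$ there is a bijection between $\mathcal P_{n,i}$ and $\mathcal L_{n-1,i+1}$. Furthermore, $$p_{n,i}=\begin{cases}1 & \text{if } i=-1,\\ \frac{n-2i-2}{i+1}\binom{n-1}{i} & \text{if } 0\le i\le\lfloor\frac{n-1}{2}\rfloor-1.\end{cases}$$
   Context: $[n]=\{1,\dots,n\}$; $\mathfrak S_n$ is the set of permutations of $[n]$ in one-line notation. The circular peak set of $\sigma\in\mathfrak S_n$ is $CP(\sigma)=\{\sigma(i)\mid 2\le i\le n-1,\ \sigma(i-1)<\sigma(i)>\sigma(i+1)\}$; for $S\subseteq[n]$, $CP_n(S)=\{\sigma\in\mathfrak S_n\mid CP(\sigma)=S\}$, and $\mathcal P_n=\{S\subseteq[n]\mid CP_n(S)\neq\emptyset\}$. $\mathcal P_{n,i}=\{S\in\mathcal P_n\mid |S|=i+1\}$ (the faces of dimension $i$) and $p_{n,i}=|\mathcal P_{n,i}|$. An $m$-left factor of a Dyck path is a word $w_1\cdots w_m$ over $\{U,D\}$ (with $U=(1,1)$, $D=(1,-1)$) which is a prefix of some Dyck path, i.e. of a lattice path from $(0,0)$ to some $(2k,0)$ with these steps never going below the $x$-axis. $\mathcal L_{m,j}$ is the set of $m$-left factors of Dyck paths whose lattice path goes from $(0,0)$ to $(m,m-2j)$ (i.e. which contain exactly $j$ letters $D$). -}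

module Defs where

open import Data.Nat using (ℕ; zero; suc)
open import Data.Fin using (Fin; toℕ; _<_)
open import Data.Fin.Subset using (Subset; _∈_; ∣_∣)
open import Data.Fin.Permutation using (Permutation′; _⟨$⟩ʳ_)
open import Data.List using (List; []; _∷_; _++_)
open import Data.Vec using (Vec; toList)
open import Data.Product using (Σ; ∃; _×_)
open import Data.Empty using (⊥)
open import Data.Unit using (⊤)
open import Data.Refinement using (Refinement)
open import Function.Bundles using (_⇔_)
open import Relation.Binary.PropositionalEquality using (_≡_)

-- [n] = {1,…,n} is modelled by Fin n = {0,…,n-1} via the order-preserving shift x ↦ x+1.
-- Positions 1..n are likewise Fin n.

IsPeakValue : ∀ {n} → Permutation′ n → Fin n → Set
IsPeakValue {n} σ j =
  Σ (Fin n) λ a → Σ (Fin n) λ b → Σ (Fin n) λ c →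
    (toℕ b ≡ suc (toℕ a)) × (toℕ c ≡ suc (toℕ b)) ×
    ((σ ⟨$⟩ʳ a) < (σ ⟨$⟩ʳ b)) × ((σ ⟨$⟩ʳ c) < (σ ⟨$⟩ʳ b)) × (σ ⟨$⟩ʳ b ≡ j)

HasCP : ∀ {n} → Permutation′ n → Subset n → Set
HasCP σ S = ∀ j → (j ∈ S) ⇔ IsPeakValue σ j

InP : (n : ℕ) → Subset n → Set
InP n S = ∃ λ (σ : Permutation′ n) → HasCP σ S

-- 𝒫_{n,k-1} : faces S ∈ 𝒫_n with |S| = k  (k = i+1).
-- The proof field is irrelevant, so elements are determined by the subset S.
PFace : ℕ → ℕ → Set
PFace n k = Refinement (Subset n) (λ S → InP n S × ∣ S ∣ ≡ k)

data Step : Set where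
  U D : Step

DyckFrom : ℕ → List Step → Set
DyckFrom h [] = h ≡ 0
DyckFrom h (U ∷ w) = DyckFrom (suc h) w
DyckFrom zero (D ∷ w) = ⊥
DyckFrom (suc h) (D ∷ w) = DyckFrom h w

IsDyck : List Step → Set
IsDyck = DyckFrom 0

IsLeftFactor : List Step → Set
IsLeftFactor w = ∃ λ v → IsDyck (w ++ v)

numD : List Step → ℕ
numD [] = 0
numD (U ∷ w) = numD w
numD (D ∷ w) = suc (numD w)

LFactor : ℕ → ℕ → Set
LFactor m j = Refinement (Vec Step m) (λ w → IsLeftFactor (toList w) × numD (toList w) ≡ j)

-- A set S ⊆ [n] is a circular peak set exactly when it is a ballot set: 1 ∉ S and every prefix {1, …, x}
-- contains at most (x − 1)/2 elements of S. Necessity: fix x; a peak of value ≤ x has both neighbours of smaller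
-- value, and they are not peaks, so if there are p ≥ 1 such peaks, they, their right neighbours and the left
-- neighbour of the first one are 2p + 1 of the x positions carrying values ≤ x. Sufficiency: insert the values
-- 1, …, n in increasing order; a value of S goes right after the first 2t + 1 letters, which hold the t peaks
-- placed so far with their neighbours, and any other value goes to the end. Dropping 1 and reading
-- the members of S as down-steps turns ballot sets into left factors of Dyck paths, which are counted by a
-- recursion on the first step and, via the reflection principle, by C(m, j) − C(m, j − 1).
module Submission where

open import Defs
open import Data.Nat as ℕ using (ℕ; zero; suc; _+_; _*_; _∸_; _/_; _≤_; _<_; _≤ᵇ_; z≤n; s≤s; s≤s⁻¹)
open import Data.Nat.Properties hiding (_≟_)
open import Data.Nat.Combinatorics using (_C_; nCk+nC[k+1]≡[n+1]C[k+1]; nC1≡n)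
open import Data.Nat.DivMod using (m*n/n≡m; m/n*n≤m)
open import Data.Nat.Tactic.RingSolver using (solve-∀)
open import Algebra.Properties.CommutativeMonoid.Sum +-0-commutativeMonoid
  using (sum; sum-cong-≗; sum-replicate-zero; sum-init-last; sum-permute; ∑-distrib-+)
open import Data.Bool using (Bool; true; false; _∧_)
open import Data.Bool.Properties using (∧-identityʳ; ¬-not; T-≡)
open import Data.Fin using (Fin; zero; suc; toℕ; inject₁; fromℕ; fromℕ<; lower₁; punchIn; punchOut; _≟_)
open import Data.Fin.Properties
  using (+↔⊎; 0↔⊥; toℕ-inject₁; toℕ-fromℕ; toℕ-fromℕ<; toℕ-injective; toℕ<n; punchInᵢ≢i; punchIn-punchOut; inject₁-lower₁)
open import Data.Fin.Permutation as Permutation using (Permutation′; _⟨$⟩ʳ_; _⟨$⟩ˡ_; inverseʳ; insert; insert-punchIn)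
open import Data.Fin.Subset using (Subset; ∣_∣)
open import Data.Vec using (Vec; []; _∷_; toList; lookup; map; tail)
open import Data.Vec.Properties using ([]=⇒lookup; lookup⇒[]=)
open import Data.List using (_++_; replicate)
open import Data.Product using (_×_; _,_; proj₁; proj₂; ∃)
open import Data.Sum using (_⊎_; inj₁; inj₂; map₂)
open import Data.Sum.Function.Propositional using (_⊎-↔_)
open import Data.Empty using (⊥)
open import Data.Empty.Irrelevant using (⊥-elim)
open import Data.Unit using (⊤; tt)
open import Data.Irrelevant using ([_])
open import Data.Refinement using (Refinement; _,_; value-injective)
open import Function using (_∘_)
open import Function.Bundles using (_↔_; _⇔_; _⤖_; mk↔ₛ′; mk⇔; Injection; Equivalence)
open import Function.Properties.Inverse using (↔-trans; ↔-sym; ↔⇒↣; ↔⇒⤖)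
open import Function.Properties.Equivalence using () renaming (sym to ⇔-sym; trans to ⇔-trans)
open import Relation.Binary.PropositionalEquality
open import Relation.Binary.Definitions using (tri<; tri≈; tri>)
open import Relation.Nullary using (yes; no; contradiction)

1+m≤ᵇ1+n : ∀ m n → (suc m ≤ᵇ suc n) ≡ (m ≤ᵇ n)
1+m≤ᵇ1+n zero n = refl
1+m≤ᵇ1+n (suc m) n = refl

≤⇒≤ᵇ≡true : ∀ {m n} → m ≤ n → (m ≤ᵇ n) ≡ true
≤⇒≤ᵇ≡true m≤n = Equivalence.to T-≡ (≤⇒≤ᵇ m≤n)

≤ᵇ≡true⇒≤ : ∀ {m n} → (m ≤ᵇ n) ≡ true → m ≤ n
≤ᵇ≡true⇒≤ {m} {n} e = ≤ᵇ⇒≤ m n (Equivalence.from T-≡ e)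

last-or-inject₁ : ∀ {n} (j : Fin (suc n)) → j ≡ fromℕ n ⊎ ∃ λ j′ → j ≡ inject₁ j′
last-or-inject₁ {n} j with n ℕ.≟ toℕ j
... | yes n≡j = inj₁ (toℕ-injective (trans (sym n≡j) (sym (toℕ-fromℕ n))))
... | no n≢j = inj₂ (lower₁ j n≢j , sym (inject₁-lower₁ j n≢j))

clamp : ∀ n → ℕ → Fin (suc n)
clamp zero _ = zero
clamp (suc n) zero = zero
clamp (suc n) (suc b) = suc (clamp n b)

toℕ-clamp : ∀ n {b} → b ≤ n → toℕ (clamp n b) ≡ b
toℕ-clamp zero z≤n = refl
toℕ-clamp (suc n) z≤n = refl
toℕ-clamp (suc n) (s≤s b≤n) = cong suc (toℕ-clamp n b≤n)

clamp-toℕ : ∀ n (i : Fin (suc n)) → clamp n (toℕ i) ≡ i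
clamp-toℕ n i = toℕ-injective (toℕ-clamp n (s≤s⁻¹ (toℕ<n i)))

toℕ-punchIn-< : ∀ {n} (p : Fin (suc n)) {k} → toℕ k < toℕ p → toℕ (punchIn p k) ≡ toℕ k
toℕ-punchIn-< (suc p) {zero} _ = refl
toℕ-punchIn-< (suc p) {suc k} (s≤s k<p) = cong suc (toℕ-punchIn-< p k<p)

toℕ-punchIn-≥ : ∀ {n} (p : Fin (suc n)) {k} → toℕ p ≤ toℕ k → toℕ (punchIn p k) ≡ suc (toℕ k)
toℕ-punchIn-≥ zero _ = refl
toℕ-punchIn-≥ (suc p) {suc k} (s≤s p≤k) = cong suc (toℕ-punchIn-≥ p p≤k)

insert-lookup : ∀ {n} (i j : Fin (suc n)) (π : Permutation′ n) → insert i j π ⟨$⟩ʳ i ≡ j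
insert-lookup i j π with i ≟ insert i j π ⟨$⟩ˡ j
... | yes i≡τ⁻¹j = trans (cong (insert i j π ⟨$⟩ʳ_) i≡τ⁻¹j) (inverseʳ (insert i j π))
... | no i≢τ⁻¹j = ⊥-elim (punchInᵢ≢i j (π ⟨$⟩ʳ punchOut i≢τ⁻¹j) (begin
  punchIn j (π ⟨$⟩ʳ punchOut i≢τ⁻¹j)             ≡⟨ insert-punchIn i j π (punchOut i≢τ⁻¹j) ⟨
  insert i j π ⟨$⟩ʳ punchIn i (punchOut i≢τ⁻¹j)  ≡⟨ cong (insert i j π ⟨$⟩ʳ_) (punchIn-punchOut i≢τ⁻¹j) ⟩
  insert i j π ⟨$⟩ʳ (insert i j π ⟨$⟩ˡ j)        ≡⟨ inverseʳ (insert i j π) ⟩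
  j                                              ∎))
  where open ≡-Reasoning

Refinement↔ : ∀ {A B : Set} {P : A → Set} {Q : B → Set} (f : A → B) (g : B → A) →
  (∀ {a} → P a → Q (f a)) → (∀ {b} → Q b → P (g b)) →
  (∀ {a} → .(P a) → g (f a) ≡ a) → (∀ b → f (g b) ≡ b) → Refinement A P ↔ Refinement B Q
Refinement↔ f g P⇒Q Q⇒P gf fg = mk↔ₛ′
  (λ { (a , [ p ]) → f a , [ P⇒Q p ] }) (λ { (b , [ q ]) → g b , [ Q⇒P q ] })
  (λ { (b , _) → value-injective (fg b) }) (λ { (a , [ p ]) → value-injective (gf p) })

-- Ballot sequences

indicator : Bool → ℕ
indicator false = 0
indicator true = 1

count : ∀ {n} → (Fin n → Bool) → ℕ
count s = sum (indicator ∘ s)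

countUpTo : ∀ {n} → (Fin n → Bool) → Fin n → ℕ
countUpTo s zero = indicator (s zero)
countUpTo s (suc x) = indicator (s zero) + countUpTo (s ∘ suc) x

-- With values shifted to 0, …, n − 1: the prefix up to value x holds at most x/2 marked values.
Ballot : ∀ {n} → (Fin n → Bool) → Set
Ballot s = ∀ x → countUpTo s x + countUpTo s x ≤ toℕ x

countUpTo-inject₁ : ∀ {n} (s : Fin (suc n) → Bool) x → countUpTo s (inject₁ x) ≡ countUpTo (s ∘ inject₁) x
countUpTo-inject₁ s zero = refl
countUpTo-inject₁ s (suc x) = cong (indicator (s zero) +_) (countUpTo-inject₁ (s ∘ suc) x)

countUpTo-fromℕ : ∀ {n} (s : Fin (suc n) → Bool) → countUpTo s (fromℕ n) ≡ count s
countUpTo-fromℕ {zero} s = sym (+-identityʳ _)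
countUpTo-fromℕ {suc n} s = cong (indicator (s zero) +_) (countUpTo-fromℕ (s ∘ suc))

Ballot-init : ∀ {n} (s : Fin (suc n) → Bool) → Ballot s → Ballot (s ∘ inject₁)
Ballot-init s ballot x = subst₂ (λ c t → c + c ≤ t) (countUpTo-inject₁ s x) (toℕ-inject₁ x) (ballot (inject₁ x))

Ballot⇒count+count≤n : ∀ {n} (s : Fin (suc n) → Bool) → Ballot s → count s + count s ≤ n
Ballot⇒count+count≤n {n} s ballot = subst₂ (λ c t → c + c ≤ t) (countUpTo-fromℕ s) (toℕ-fromℕ n) (ballot (fromℕ n))

Ballot-head : ∀ {n} {s : Fin (suc n) → Bool} → Ballot s → s zero ≡ false
Ballot-head {s = s} ballot with s zero | ballot zero
... | false | _ = refl
... | true | ()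

count-init-last : ∀ {n} (s : Fin (suc n) → Bool) → count s ≡ count (s ∘ inject₁) + indicator (s (fromℕ n))
count-init-last s = sum-init-last (indicator ∘ s)

countUpTo≡count : ∀ {n} (s : Fin n → Bool) x → countUpTo s x ≡ count (λ v → (toℕ v ≤ᵇ toℕ x) ∧ s v)
countUpTo≡count {suc n} s zero = sym (trans (cong (indicator (s zero) +_) (sum-replicate-zero n)) (+-identityʳ _))
countUpTo≡count s (suc x) = cong (indicator (s zero) +_) (trans (countUpTo≡count (s ∘ suc) x)
  (sum-cong-≗ (λ v → cong (λ b → indicator (b ∧ s (suc v))) (sym (1+m≤ᵇ1+n (toℕ v) (toℕ x))))))

count-≤ᵇ : ∀ {n} (x : Fin n) → count {n} (λ v → toℕ v ≤ᵇ toℕ x) ≡ suc (toℕ x)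
count-≤ᵇ {n} x = begin
  count {n} (λ v → toℕ v ≤ᵇ toℕ x)             ≡⟨ sum-cong-≗ {n} (λ v → cong indicator (∧-identityʳ (toℕ v ≤ᵇ toℕ x))) ⟨
  count {n} (λ v → (toℕ v ≤ᵇ toℕ x) ∧ true)    ≡⟨ countUpTo≡count (λ _ → true) x ⟨
  countUpTo (λ _ → true) x                     ≡⟨ countUpTo-all x ⟩
  suc (toℕ x)                                  ∎
  where
  open ≡-Reasoning
  countUpTo-all : ∀ {n} (x : Fin n) → countUpTo (λ _ → true) x ≡ suc (toℕ x)
  countUpTo-all zero = refl
  countUpTo-all (suc x) = cong suc (countUpTo-all x)

-- Necessity of the ballot condition

data Level : Set where
  high low peak : Level

isPeak isLow : Level → Bool
isPeak peak = true
isPeak _ = false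
isLow low = true
isLow _ = false

Adjacent : ∀ {n} → Fin n → Fin n → Set
Adjacent a b = toℕ b ≡ suc (toℕ a)

FollowedByLow PrecededByLow : ∀ {n} → (Fin n → Level) → Set
FollowedByLow k = ∀ b → k b ≡ peak → ∃ λ c → Adjacent b c × k c ≡ low
PrecededByLow k = ∀ a c → Adjacent a c → k c ≡ peak → k a ≡ low

indicator≤1 : ∀ b → indicator b ≤ 1
indicator≤1 false = z≤n
indicator≤1 true = ≤-refl

head-true⇒1≤count : ∀ {n} (s : Fin (suc n) → Bool) → s zero ≡ true → 1 ≤ count s
head-true⇒1≤count s s₀ rewrite s₀ = s≤s z≤n

-- The last summand pays for a peak in front, whose preceding low lies outside the sequence.
fewer-peaks-than-lows : ∀ {n} (k : Fin (suc n) → Level) → FollowedByLow k → PrecededByLow k →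
  count (isPeak ∘ k) ≡ 0 ⊎ count (isPeak ∘ k) < count (isLow ∘ k) + indicator (isPeak (k zero))
fewer-peaks-than-lows {zero} k followed _ with k zero in k₀
... | high = inj₁ refl
... | low = inj₁ refl
... | peak with followed zero k₀
...   | zero , () , _
fewer-peaks-than-lows {suc n} k followed preceded =
  extend (k zero) refl (fewer-peaks-than-lows (k ∘ suc) followed′ (λ a c → preceded (suc a) (suc c) ∘ cong suc))
  where
  followed′ : FollowedByLow (k ∘ suc)
  followed′ b kb with followed (suc b) kb
  ... | suc c , c≡1+b , kc = c , suc-injective c≡1+b , kc

  P L h : ℕ
  P = count (isPeak ∘ k ∘ suc)
  L = count (isLow ∘ k ∘ suc)
  h = indicator (isPeak (k (suc zero)))

  extend : ∀ l → k zero ≡ l → P ≡ 0 ⊎ P < L + h →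
    indicator (isPeak l) + P ≡ 0 ⊎ indicator (isPeak l) + P < indicator (isLow l) + L + indicator (isPeak l)
  extend high _ (inj₁ P≡0) = inj₁ P≡0
  extend high k₀ (inj₂ P<L+h) = inj₂ (subst (λ h → P < L + h) (second-not-peak (k (suc zero)) refl) P<L+h)
    where
    second-not-peak : ∀ l → k (suc zero) ≡ l → indicator (isPeak l) ≡ 0
    second-not-peak peak k₁ with () ← trans (sym k₀) (preceded zero (suc zero) refl k₁)
    second-not-peak high _ = refl
    second-not-peak low _ = refl
  extend low _ (inj₁ P≡0) = inj₁ P≡0
  extend low _ (inj₂ P<L+h) = inj₂ (<-≤-trans P<L+h (subst (L + h ≤_) (+-suc L 0) (+-monoʳ-≤ L (indicator≤1 _))))
  extend peak k₀ ih with followed zero k₀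
  ... | suc zero , _ , k₁ = inj₂ (step (map₂ (subst (λ h → P < L + h) (cong (indicator ∘ isPeak) k₁)) ih))
    where
    1≤L : 1 ≤ L
    1≤L = head-true⇒1≤count (isLow ∘ k ∘ suc) (cong isLow k₁)
    step : P ≡ 0 ⊎ P < L + 0 → suc P < L + 1
    step (inj₁ P≡0) = subst (λ P → suc P < L + 1) (sym P≡0) (+-monoˡ-≤ 1 1≤L)
    step (inj₂ P<L) = subst (suc (suc P) ≤_) (sym (+-suc L 0)) (s≤s P<L)

level : Bool → Bool → Level
level false _ = high
level true false = low
level true true = peak

level≡peak : ∀ {a b} → level a b ≡ peak → a ≡ true × b ≡ true
level≡peak {true} {true} _ = refl , refl

isPeak-level : ∀ a b → isPeak (level a b) ≡ a ∧ b
isPeak-level false _ = refl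
isPeak-level true false = refl
isPeak-level true true = refl

isPeak+isLow-level : ∀ a b → indicator (isPeak (level a b)) + indicator (isLow (level a b)) ≡ indicator a
isPeak+isLow-level false _ = refl
isPeak+isLow-level true false = refl
isPeak+isLow-level true true = refl

module PeakPositions {n} (σ : Permutation′ n) where

  PeakPosition : Fin n → Set
  PeakPosition b = ∃ λ a → ∃ λ c → Adjacent a b × Adjacent b c ×
    toℕ (σ ⟨$⟩ʳ a) < toℕ (σ ⟨$⟩ʳ b) × toℕ (σ ⟨$⟩ʳ c) < toℕ (σ ⟨$⟩ʳ b)

  peakPosition : ∀ b → IsPeakValue σ (σ ⟨$⟩ʳ b) → PeakPosition b
  peakPosition b (a , b′ , c , a~b′ , b′~c , σa<σb′ , σc<σb′ , σb′≡σb)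
    with refl ← Injection.injective (↔⇒↣ σ) σb′≡σb = a , c , a~b′ , b′~c , σa<σb′ , σc<σb′

  adjacent-peaks : ∀ {a b} → Adjacent a b → PeakPosition a → PeakPosition b → ⊥
  adjacent-peaks {a} {b} a~b (_ , c , _ , a~c , _ , σc<σa) (a′ , _ , a′~b , _ , σa′<σb , _)
    with refl ← toℕ-injective (trans a~c (sym a~b)) | refl ← toℕ-injective (suc-injective (trans (sym a′~b) a~b))
    = <-asym σc<σa σa′<σb

module Necessity {n} (σ : Permutation′ n) (s : Fin n → Bool)
                 (marked⇒peak : ∀ j → s j ≡ true → IsPeakValue σ j) (x : Fin n) where

  open PeakPositions σ

  levelOfValue : Fin n → Level
  levelOfValue v = level (toℕ v ≤ᵇ toℕ x) (s v)

  levels : Fin n → Level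
  levels = levelOfValue ∘ (σ ⟨$⟩ʳ_)

  count-permute : ∀ (f : Fin n → Bool) → count (f ∘ (σ ⟨$⟩ʳ_)) ≡ count f
  count-permute f = sym (sum-permute (indicator ∘ f) σ)

  levels≡peak : ∀ {b} → levels b ≡ peak → toℕ (σ ⟨$⟩ʳ b) ≤ toℕ x × PeakPosition b
  levels≡peak {b} lb = ≤ᵇ≡true⇒≤ (proj₁ (level≡peak lb)) , peakPosition b (marked⇒peak _ (proj₂ (level≡peak lb)))

  low-neighbour : ∀ {a b} → Adjacent a b ⊎ Adjacent b a → levels b ≡ peak →
    toℕ (σ ⟨$⟩ʳ a) < toℕ (σ ⟨$⟩ʳ b) → levels a ≡ low
  low-neighbour {a} {b} adjacent lb σa<σb =
    cong₂ level (≤⇒≤ᵇ≡true (≤-trans (<⇒≤ σa<σb) σb≤x)) (¬-not (λ sa → both-peaks adjacent (peakPosition a (marked⇒peak _ sa))))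
    where
    σb≤x : toℕ (σ ⟨$⟩ʳ b) ≤ toℕ x
    σb≤x = proj₁ (levels≡peak lb)
    both-peaks : Adjacent a b ⊎ Adjacent b a → PeakPosition a → ⊥
    both-peaks (inj₁ a~b) pa = adjacent-peaks a~b pa (proj₂ (levels≡peak lb))
    both-peaks (inj₂ b~a) pa = adjacent-peaks b~a (proj₂ (levels≡peak lb)) pa

  followedByLow : FollowedByLow levels
  followedByLow b lb with levels≡peak lb
  ... | _ , (_ , c , _ , b~c , _ , σc<σb) = c , b~c , low-neighbour (inj₂ b~c) lb σc<σb

  precededByLow : PrecededByLow levels
  precededByLow a b a~b lb with levels≡peak lb
  ... | _ , (a′ , _ , a′~b , _ , σa′<σb , _) with refl ← toℕ-injective (suc-injective (trans (sym a′~b) a~b))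
    = low-neighbour (inj₁ a~b) lb σa′<σb

  first-not-peak : ∀ z → toℕ z ≡ 0 → isPeak (levels z) ≡ false
  first-not-peak z z≡0 with levels z in lz
  ... | high = refl
  ... | low = refl
  ... | peak with levels≡peak lz
  ...   | _ , (_ , _ , a~z , _) with () ← trans (sym z≡0) a~z

  #peaks≡countUpTo : count (isPeak ∘ levels) ≡ countUpTo s x
  #peaks≡countUpTo = begin
    count (isPeak ∘ levelOfValue ∘ (σ ⟨$⟩ʳ_))          ≡⟨ count-permute (isPeak ∘ levelOfValue) ⟩
    count (isPeak ∘ levelOfValue)                      ≡⟨ sum-cong-≗ (λ v → cong indicator (isPeak-level (toℕ v ≤ᵇ toℕ x) (s v))) ⟩
    count {n} (λ v → (toℕ v ≤ᵇ toℕ x) ∧ s v)           ≡⟨ countUpTo≡count s x ⟨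
    countUpTo s x                                      ∎
    where open ≡-Reasoning

  #peaks+#lows≡1+x : count (isPeak ∘ levels) + count (isLow ∘ levels) ≡ suc (toℕ x)
  #peaks+#lows≡1+x = begin
    count (isPeak ∘ levels) + count (isLow ∘ levels)
      ≡⟨ ∑-distrib-+ (indicator ∘ isPeak ∘ levels) (indicator ∘ isLow ∘ levels) ⟨
    sum (λ b → indicator (isPeak (levels b)) + indicator (isLow (levels b)))
      ≡⟨ sum-cong-≗ (λ b → isPeak+isLow-level (toℕ (σ ⟨$⟩ʳ b) ≤ᵇ toℕ x) (s (σ ⟨$⟩ʳ b))) ⟩
    count ((λ v → toℕ v ≤ᵇ toℕ x) ∘ (σ ⟨$⟩ʳ_))
      ≡⟨ count-permute (λ v → toℕ v ≤ᵇ toℕ x) ⟩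
    count {n} (λ v → toℕ v ≤ᵇ toℕ x)
      ≡⟨ count-≤ᵇ x ⟩
    suc (toℕ x) ∎
    where open ≡-Reasoning

peaks⇒ballot : ∀ {n} (σ : Permutation′ n) (s : Fin n → Bool) → (∀ j → s j ≡ true → IsPeakValue σ j) → Ballot s
peaks⇒ballot {suc n} σ s marked⇒peak x =
  subst (λ c → c + c ≤ toℕ x) #peaks≡countUpTo (double≤ fewer #peaks+#lows≡1+x)
  where
  open Necessity σ s marked⇒peak x
  fewer : count (isPeak ∘ levels) ≡ 0 ⊎ count (isPeak ∘ levels) < count (isLow ∘ levels)
  fewer = map₂ (subst (count (isPeak ∘ levels) <_)
                      (trans (cong (λ p → count (isLow ∘ levels) + indicator p) (first-not-peak zero refl)) (+-identityʳ _)))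
               (fewer-peaks-than-lows levels followedByLow precededByLow)
  double≤ : ∀ {P L X} → P ≡ 0 ⊎ P < L → P + L ≡ suc X → P + P ≤ X
  double≤ (inj₁ refl) _ = z≤n
  double≤ {P} (inj₂ P<L) P+L≡1+X = s≤s⁻¹ (subst (suc (P + P) ≤_) P+L≡1+X (+-monoʳ-< P P<L))

-- Sufficiency of the ballot condition

-- The one-line notation of σ as a word indexed by ℕ; past position n it repeats its last letter.
word : ∀ {n} → Permutation′ (suc n) → ℕ → ℕ
word {n} σ b = toℕ (σ ⟨$⟩ʳ clamp n b)

word≤n : ∀ {n} (σ : Permutation′ (suc n)) b → word σ b ≤ n
word≤n σ b = s≤s⁻¹ (toℕ<n _)

word-toℕ : ∀ {n} (σ : Permutation′ (suc n)) {i k} → toℕ i ≡ k → word σ k ≡ toℕ (σ ⟨$⟩ʳ i)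
word-toℕ {n} σ {i} refl = cong (λ k → toℕ (σ ⟨$⟩ʳ k)) (clamp-toℕ n i)

PeakTriple : (ℕ → ℕ) → ℕ → ℕ → Set
PeakTriple w L a = suc (suc a) < L × w a < w (suc a) × w (suc (suc a)) < w (suc a)

PeakValueOf : (ℕ → ℕ) → ℕ → ℕ → Set
PeakValueOf w L v = ∃ λ a → PeakTriple w L a × w (suc a) ≡ v

isPeakValue⇔ : ∀ {n} (σ : Permutation′ (suc n)) j → IsPeakValue σ j ⇔ PeakValueOf (word σ) (suc n) (toℕ j)
isPeakValue⇔ {n} σ j = mk⇔ to from
  where
  to : IsPeakValue σ j → PeakValueOf (word σ) (suc n) (toℕ j)
  to (a , b , c , a~b , b~c , σa<σb , σc<σb , σb≡j) =
    toℕ a , (subst (_< suc n) a~c (toℕ<n c) , subst₂ _<_ (sym (word-toℕ σ refl)) (sym wb) σa<σb , subst₂ _<_ (sym wc) (sym wb) σc<σb) ,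
    trans wb (cong toℕ σb≡j)
    where
    a~c : toℕ c ≡ suc (suc (toℕ a))
    a~c = trans b~c (cong suc a~b)
    wb : word σ (suc (toℕ a)) ≡ toℕ (σ ⟨$⟩ʳ b)
    wb = word-toℕ σ a~b
    wc : word σ (suc (suc (toℕ a))) ≡ toℕ (σ ⟨$⟩ʳ c)
    wc = word-toℕ σ a~c

  from : PeakValueOf (word σ) (suc n) (toℕ j) → IsPeakValue σ j
  from (a , (2+a≤n , w₀<w₁ , w₂<w₁) , w₁≡j) =
    clamp n a , clamp n (suc a) , clamp n (suc (suc a)) ,
    trans (toℕ-clamp n 1+a≤n) (cong suc (sym (toℕ-clamp n a≤n))) ,
    trans (toℕ-clamp n (s≤s⁻¹ 2+a≤n)) (cong suc (sym (toℕ-clamp n 1+a≤n))) ,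
    w₀<w₁ , w₂<w₁ , toℕ-injective w₁≡j
    where
    1+a≤n : suc a ≤ n
    1+a≤n = ≤-trans (n≤1+n _) (s≤s⁻¹ 2+a≤n)
    a≤n : a ≤ n
    a≤n = ≤-trans (n≤1+n _) 1+a≤n

PeakTriple-transport : ∀ (w u : ℕ → ℕ) {L M a c} → suc (suc c) < M →
  w a ≡ u c → w (suc a) ≡ u (suc c) → w (suc (suc a)) ≡ u (suc (suc c)) → PeakTriple w L a → PeakTriple u M c
PeakTriple-transport _ _ 2+c<M e₀ e₁ e₂ (_ , w₀<w₁ , w₂<w₁) = 2+c<M , subst₂ _<_ e₀ e₁ w₀<w₁ , subst₂ _<_ e₂ e₁ w₂<w₁

PeaksEndBefore : (ℕ → ℕ) → ℕ → ℕ → Set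
PeaksEndBefore w L r = ∀ a → PeakTriple w L a → suc (suc a) < r

record MaxInsertion (n : ℕ) (w w′ : ℕ → ℕ) (P : ℕ) : Set where
  field
    P≤1+n  : P ≤ suc n
    w≤n    : ∀ b → w b ≤ n
    w′≤1+n : ∀ b → w′ b ≤ suc n
    before : ∀ {b} → b < P → w′ b ≡ w b
    at     : w′ P ≡ suc n
    after  : ∀ {b} → P ≤ b → b ≤ n → w′ (suc b) ≡ w b

module MaxInsertionProperties {n w w′ P} (ins : MaxInsertion n w w′ P) where

  open MaxInsertion ins

  triple-before : ∀ {a} → suc (suc a) < P → PeakTriple w (suc n) a → PeakTriple w′ (suc (suc n)) a
  triple-before 2+a<P t = PeakTriple-transport w w′ (m<n⇒m<1+n (proj₁ t))
    (sym (before (<-trans (n<1+n _) (<-trans (n<1+n _) 2+a<P)))) (sym (before (<-trans (n<1+n _) 2+a<P))) (sym (before 2+a<P)) t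

  triple-before⁻ : ∀ {a} → suc (suc a) < P → PeakTriple w′ (suc (suc n)) a → PeakTriple w (suc n) a
  triple-before⁻ 2+a<P = PeakTriple-transport w′ w (<-≤-trans 2+a<P P≤1+n)
    (before (<-trans (n<1+n _) (<-trans (n<1+n _) 2+a<P))) (before (<-trans (n<1+n _) 2+a<P)) (before 2+a<P)

  triple-after⁻ : ∀ {a} → P ≤ a → PeakTriple w′ (suc (suc n)) (suc a) → PeakTriple w (suc n) a
  triple-after⁻ {a} P≤a t = PeakTriple-transport w′ w 2+a<1+n
    (after P≤a (≤-trans (n≤1+n _) 1+a≤n)) (after (m≤n⇒m≤1+n P≤a) 1+a≤n) (after (m≤n⇒m≤1+n (m≤n⇒m≤1+n P≤a)) 2+a≤n) t
    where
    2+a<1+n : suc (suc a) < suc n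
    2+a<1+n = s≤s⁻¹ (proj₁ t)
    2+a≤n : suc (suc a) ≤ n
    2+a≤n = s≤s⁻¹ 2+a<1+n
    1+a≤n : suc a ≤ n
    1+a≤n = ≤-trans (n≤1+n _) 2+a≤n

  max-not-below : ∀ {b c} → w′ b ≡ suc n → w′ b < w′ c → ⊥
  max-not-below {c = c} w′b≡1+n w′b<w′c = 1+n≰n (subst (_< suc n) w′b≡1+n (<-≤-trans w′b<w′c (w′≤1+n c)))

  w′≡1+n⇒≡P : ∀ {b} → b ≤ suc n → w′ b ≡ suc n → b ≡ P
  w′≡1+n⇒≡P {b} b≤1+n w′b≡1+n with <-cmp b P
  ... | tri< b<P _ _ = ⊥-elim (1+n≰n (subst (_≤ n) (trans (sym (before b<P)) w′b≡1+n) (w≤n b)))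
  ... | tri≈ _ b≡P _ = b≡P
  ... | tri> _ _ (s≤s P≤b₀) = ⊥-elim (1+n≰n (subst (_≤ n) (trans (sym (after P≤b₀ (s≤s⁻¹ b≤1+n))) w′b≡1+n) (w≤n _)))

  triple-at : ∀ {p} → suc p ≡ P → P ≤ n → PeakTriple w′ (suc (suc n)) p
  triple-at refl P≤n =
    s≤s (s≤s P≤n) ,
    subst₂ _<_ (sym (before ≤-refl)) (sym at) (s≤s (w≤n _)) ,
    subst₂ _<_ (sym (after ≤-refl P≤n)) (sym at) (s≤s (w≤n _))

  module _ {r} (r≤P : r ≤ P) (ends : PeaksEndBefore w (suc n) r) where

    triple-after-insertion : ∀ {a} → PeakTriple w′ (suc (suc n)) a → suc a ≡ P ⊎ suc (suc a) < r
    triple-after-insertion {a} t with <-cmp (suc a) P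
    ... | tri≈ _ 1+a≡P _ = inj₁ 1+a≡P
    ... | tri< 1+a<P _ _ with m≤n⇒m<n∨m≡n 1+a<P
    ...   | inj₁ 2+a<P = inj₂ (ends a (triple-before⁻ 2+a<P t))
    ...   | inj₂ 2+a≡P = ⊥-elim (max-not-below (trans (cong w′ 2+a≡P) at) (proj₂ (proj₂ t)))
    triple-after-insertion {a} t | tri> _ _ P<1+a with m≤n⇒m<n∨m≡n (s≤s⁻¹ P<1+a)
    ...   | inj₂ P≡a = ⊥-elim (max-not-below (trans (cong w′ (sym P≡a)) at) (proj₁ (proj₂ t)))
    ...   | inj₁ (s≤s P≤a₀) =
      ⊥-elim (<⇒≱ (s≤s (≤-trans (n≤1+n _) (n≤1+n _))) (≤-trans (ends _ (triple-after⁻ P≤a₀ t)) (≤-trans r≤P P≤a₀)))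

    peakValue-preserved : ∀ {v} → v ≤ n → PeakValueOf w′ (suc (suc n)) v ⇔ PeakValueOf w (suc n) v
    peakValue-preserved {v} v≤n = mk⇔ to from
      where
      to : PeakValueOf w′ (suc (suc n)) v → PeakValueOf w (suc n) v
      to (a , t , w′₁≡v) with triple-after-insertion t
      ... | inj₁ 1+a≡P = ⊥-elim (1+n≰n (subst (_≤ n) (trans (sym w′₁≡v) (trans (cong w′ 1+a≡P) at)) v≤n))
      ... | inj₂ 2+a<r = a , triple-before⁻ 2+a<P t , trans (sym (before (<-trans (n<1+n _) 2+a<P))) w′₁≡v
        where
        2+a<P : suc (suc a) < P
        2+a<P = <-≤-trans 2+a<r r≤P

      from : PeakValueOf w (suc n) v → PeakValueOf w′ (suc (suc n)) v
      from (a , t , w₁≡v) = a , triple-before 2+a<P t , trans (before (<-trans (n<1+n _) 2+a<P)) w₁≡v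
        where
        2+a<P : suc (suc a) < P
        2+a<P = <-≤-trans (ends a t) r≤P

    peaksEndBefore-insertion : ∀ {r′} → r ≤ r′ → (P ≤ n → suc P < r′) → PeaksEndBefore w′ (suc (suc n)) r′
    peaksEndBefore-insertion {r′} r≤r′ peak⇒ a t with triple-after-insertion t
    ... | inj₁ 1+a≡P = subst (λ x → suc x < r′) (sym 1+a≡P) (peak⇒ (subst (_≤ n) 1+a≡P (s≤s⁻¹ (s≤s⁻¹ (proj₁ t)))))
    ... | inj₂ 2+a<r = <-≤-trans 2+a<r r≤r′

  max-isPeakValue⇔ : ∀ {p} → suc p ≡ P → PeakValueOf w′ (suc (suc n)) (suc n) ⇔ P ≤ n
  max-isPeakValue⇔ {p} 1+p≡P = mk⇔ to (λ P≤n → p , triple-at 1+p≡P P≤n , trans (cong w′ 1+p≡P) at)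
    where
    to : PeakValueOf w′ (suc (suc n)) (suc n) → P ≤ n
    to (a , (3+a≤2+n , _) , w′₁≡1+n) = subst (_≤ n) (w′≡1+n⇒≡P (m≤n⇒m≤1+n 1+a≤n) w′₁≡1+n) 1+a≤n
      where
      1+a≤n : suc a ≤ n
      1+a≤n = s≤s⁻¹ (s≤s⁻¹ 3+a≤2+n)

insert-max : ∀ {n} (σ : Permutation′ (suc n)) (p : Fin (suc (suc n))) →
  MaxInsertion n (word σ) (word (insert p (fromℕ (suc n)) σ)) (toℕ p)
insert-max {n} σ p = record
  { P≤1+n  = s≤s⁻¹ (toℕ<n p)
  ; w≤n    = word≤n σ
  ; w′≤1+n = word≤n τ
  ; before = λ b<p → shifted (trans (toℕ-punchIn-< p (subst (_< toℕ p) (sym (toℕ-clamp n (b≤n b<p))) b<p)) (toℕ-clamp n (b≤n b<p)))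
  ; at     = trans (word-toℕ τ refl) (trans (cong toℕ (insert-lookup p (fromℕ (suc n)) σ)) (toℕ-fromℕ (suc n)))
  ; after  = λ p≤b b≤n → shifted (trans (toℕ-punchIn-≥ p (subst (toℕ p ≤_) (sym (toℕ-clamp n b≤n)) p≤b)) (cong suc (toℕ-clamp n b≤n)))
  }
  where
  τ : Permutation′ (suc (suc n))
  τ = insert p (fromℕ (suc n)) σ
  b≤n : ∀ {b} → b < toℕ p → b ≤ n
  b≤n b<p = s≤s⁻¹ (<-≤-trans b<p (s≤s⁻¹ (toℕ<n p)))
  shifted : ∀ {b c} → toℕ (punchIn p (clamp n b)) ≡ c → word τ c ≡ word σ b
  shifted {b} e = trans (word-toℕ τ e) (trans (cong toℕ (insert-punchIn p (fromℕ (suc n)) σ (clamp n b)))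
    (toℕ-punchIn-< (fromℕ (suc n)) (subst (toℕ (σ ⟨$⟩ʳ clamp n b) <_) (sym (toℕ-fromℕ (suc n))) (toℕ<n _))))

Realises : ∀ {n} → Permutation′ (suc n) → (Fin (suc n) → Bool) → Set
Realises {n} σ s = ∀ j → s j ≡ true ⇔ PeakValueOf (word σ) (suc n) (toℕ j)

Realisation : ∀ {n} → (Fin (suc n) → Bool) → Set
Realisation {n} s = ∃ λ σ → Realises σ s × PeaksEndBefore (word σ) (suc n) (suc (count s + count s))

-- A marked maximum is inserted after the first 2t + 1 letters, which hold the t earlier peaks with their
-- neighbours; an unmarked one goes to the end.
module Extension {n} (s : Fin (suc (suc n)) → Bool) (ballot : Ballot s) (realisation : Realisation (s ∘ inject₁)) where

  σ : Permutation′ (suc n)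
  σ = proj₁ realisation

  t : ℕ
  t = count (s ∘ inject₁)

  realises : Realises σ (s ∘ inject₁)
  realises = proj₁ (proj₂ realisation)

  ends : PeaksEndBefore (word σ) (suc n) (suc (t + t))
  ends = proj₂ (proj₂ realisation)

  module _ (p : Fin (suc (suc n))) (2t<p : suc (t + t) ≤ toℕ p) where

    τ : Permutation′ (suc (suc n))
    τ = insert p (fromℕ (suc n)) σ
    open MaxInsertionProperties (insert-max σ p)

    realises-τ : ∀ {q} → suc q ≡ toℕ p → (s (fromℕ (suc n)) ≡ true ⇔ toℕ p ≤ n) → Realises τ s
    realises-τ 1+q≡p last⇔ j with last-or-inject₁ j
    ... | inj₁ refl = subst (λ v → s (fromℕ (suc n)) ≡ true ⇔ PeakValueOf (word τ) (suc (suc n)) v) (sym (toℕ-fromℕ (suc n)))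
      (⇔-trans last⇔ (⇔-sym (max-isPeakValue⇔ 1+q≡p)))
    ... | inj₂ (j′ , refl) = subst (λ v → s (inject₁ j′) ≡ true ⇔ PeakValueOf (word τ) (suc (suc n)) v) (sym (toℕ-inject₁ j′))
      (⇔-trans (realises j′) (⇔-sym (peakValue-preserved 2t<p ends (s≤s⁻¹ (toℕ<n j′)))))

    ends-τ : ∀ {c} → c ≡ count s → t ≤ c → (toℕ p ≤ n → suc (toℕ p) < suc (c + c)) →
      PeaksEndBefore (word τ) (suc (suc n)) (suc (count s + count s))
    ends-τ refl t≤c = peaksEndBefore-insertion 2t<p ends (s≤s (+-mono-≤ t≤c t≤c))

  marked : s (fromℕ (suc n)) ≡ true → Realisation s
  marked sₙ = τ p 2t<p , realises-τ p 2t<p (sym p≡) (mk⇔ (λ _ → subst (_≤ n) (sym p≡) 1+2t≤n) (λ _ → sₙ)) ,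
    ends-τ p 2t<p (sym count≡) (n≤1+n t) (λ _ → subst (λ x → suc x < suc (suc t + suc t)) (sym p≡) (s≤s (s≤s (≤-reflexive (sym (+-suc t t))))))
    where
    count≡ : count s ≡ suc t
    count≡ = trans (count-init-last s) (trans (cong (λ b → t + indicator b) sₙ) (+-comm t 1))
    1+2t≤n : suc (t + t) ≤ n
    1+2t≤n = subst (_≤ n) (+-suc t t) (s≤s⁻¹ (subst (λ c → c + c ≤ suc n) count≡ (Ballot⇒count+count≤n s ballot)))
    p : Fin (suc (suc n))
    p = fromℕ< (s≤s (m≤n⇒m≤1+n 1+2t≤n))
    p≡ : toℕ p ≡ suc (t + t)
    p≡ = toℕ-fromℕ< (s≤s (m≤n⇒m≤1+n 1+2t≤n))
    2t<p : suc (t + t) ≤ toℕ p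
    2t<p = ≤-reflexive (sym p≡)

  unmarked : s (fromℕ (suc n)) ≡ false → Realisation s
  unmarked sₙ = τ p 2t<p , realises-τ p 2t<p (sym p≡) (mk⇔ (λ sₙ′ → contradiction (trans (sym sₙ) sₙ′) λ ()) p≤n⇒⊥) ,
    ends-τ p 2t<p (sym count≡) ≤-refl p≤n⇒⊥
    where
    count≡ : count s ≡ t
    count≡ = trans (count-init-last s) (trans (cong (λ b → t + indicator b) sₙ) (+-identityʳ t))
    p : Fin (suc (suc n))
    p = fromℕ (suc n)
    p≡ : toℕ p ≡ suc n
    p≡ = toℕ-fromℕ (suc n)
    2t<p : suc (t + t) ≤ toℕ p
    2t<p = subst (suc (t + t) ≤_) (sym p≡) (s≤s (Ballot⇒count+count≤n (s ∘ inject₁) (Ballot-init s ballot)))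
    p≤n⇒⊥ : ∀ {A : Set} → toℕ p ≤ n → A
    p≤n⇒⊥ p≤n = ⊥-elim (1+n≰n (subst (_≤ n) p≡ p≤n))

ballot⇒realisation : ∀ n (s : Fin (suc n) → Bool) → Ballot s → Realisation s
ballot⇒realisation zero s ballot = Permutation.id , realises , λ { _ (s≤s () , _) }
  where
  realises : Realises Permutation.id s
  realises zero = mk⇔ (λ s₀ → contradiction (trans (sym (Ballot-head ballot)) s₀) λ ()) λ { (_ , (s≤s () , _) , _) }
ballot⇒realisation (suc n) s ballot with s (fromℕ (suc n)) in sₙ
... | true = Extension.marked s ballot (ballot⇒realisation n (s ∘ inject₁) (Ballot-init s ballot)) sₙ
... | false = Extension.unmarked s ballot (ballot⇒realisation n (s ∘ inject₁) (Ballot-init s ballot)) sₙ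

inP⇔ballot : ∀ {m} (S : Subset (suc m)) → InP (suc m) S ⇔ Ballot (lookup S)
inP⇔ballot {m} S = mk⇔
  (λ (σ , hasCP) → peaks⇒ballot σ (lookup S) (λ j Sj → Equivalence.to (hasCP j) (lookup⇒[]= j S Sj)))
  (λ ballot → let σ , realises , _ = ballot⇒realisation m (lookup S) ballot in
    σ , λ j → ⇔-trans (mk⇔ []=⇒lookup (lookup⇒[]= j S)) (⇔-trans (realises j) (⇔-sym (isPeakValue⇔ σ j))))

-- Left factors and ballot sequences

NonNegativeFrom : ∀ {m} → ℕ → Vec Step m → Set
NonNegativeFrom h [] = ⊤
NonNegativeFrom h (U ∷ w) = NonNegativeFrom (suc h) w
NonNegativeFrom zero (D ∷ w) = ⊥
NonNegativeFrom (suc h) (D ∷ w) = NonNegativeFrom h w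

toStep : Bool → Step
toStep true = D
toStep false = U

fromStep : Step → Bool
fromStep D = true
fromStep U = false

map-toStep-fromStep : ∀ {m} (w : Vec Step m) → map toStep (map fromStep w) ≡ w
map-toStep-fromStep [] = refl
map-toStep-fromStep (U ∷ w) = cong (U ∷_) (map-toStep-fromStep w)
map-toStep-fromStep (D ∷ w) = cong (D ∷_) (map-toStep-fromStep w)

map-fromStep-toStep : ∀ {m} (S : Vec Bool m) → map fromStep (map toStep S) ≡ S
map-fromStep-toStep [] = refl
map-fromStep-toStep (true ∷ S) = cong (true ∷_) (map-fromStep-toStep S)
map-fromStep-toStep (false ∷ S) = cong (false ∷_) (map-fromStep-toStep S)

numD-map-toStep : ∀ {m} (S : Vec Bool m) → numD (toList (map toStep S)) ≡ ∣ S ∣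
numD-map-toStep [] = refl
numD-map-toStep (true ∷ S) = cong suc (numD-map-toStep S)
numD-map-toStep (false ∷ S) = numD-map-toStep S

∣map-fromStep∣ : ∀ {m} (w : Vec Step m) → ∣ map fromStep w ∣ ≡ numD (toList w)
∣map-fromStep∣ [] = refl
∣map-fromStep∣ (U ∷ w) = ∣map-fromStep∣ w
∣map-fromStep∣ (D ∷ w) = cong suc (∣map-fromStep∣ w)

BallotFrom : ∀ {m} → ℕ → Vec Bool m → Set
BallotFrom h S = ∀ x → countUpTo (lookup S) x + countUpTo (lookup S) x ≤ h + suc (toℕ x)

Ballot-false∷⇔ : ∀ {m} (S : Vec Bool m) → Ballot (lookup (false ∷ S)) ⇔ BallotFrom 0 S
Ballot-false∷⇔ S = mk⇔ (λ ballot x → ballot (suc x)) λ { ballot zero → z≤n ; ballot (suc x) → ballot x }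

suc-double-≤⇔ : ∀ c h y → suc c + suc c ≤ suc h + suc y ⇔ c + c ≤ h + y
suc-double-≤⇔ c h y = mk⇔ (λ le → s≤s⁻¹ (s≤s⁻¹ (subst₂ _≤_ e₁ e₂ le))) (λ le → subst₂ _≤_ (sym e₁) (sym e₂) (s≤s (s≤s le)))
  where
  e₁ : suc c + suc c ≡ suc (suc (c + c))
  e₁ = cong suc (+-suc c c)
  e₂ : suc h + suc y ≡ suc (suc (h + y))
  e₂ = cong suc (+-suc h y)

nonNegative⇔ballotFrom : ∀ {m} h (S : Vec Bool m) → NonNegativeFrom h (map toStep S) ⇔ BallotFrom h S
nonNegative⇔ballotFrom h [] = mk⇔ (λ _ ()) (λ _ → tt)
nonNegative⇔ballotFrom zero (true ∷ S) = mk⇔ (λ ()) (λ ballot → contradiction (ballot zero) λ { (s≤s ()) })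
nonNegative⇔ballotFrom (suc h) (true ∷ S) = mk⇔
  (λ nn → λ { zero → s≤s (m≤n+m 1 h) ; (suc x) → Equivalence.from (suc-double-≤⇔ _ h (suc (toℕ x))) (Equivalence.to (nonNegative⇔ballotFrom h S) nn x) })
  (λ ballot → Equivalence.from (nonNegative⇔ballotFrom h S) (λ x → Equivalence.to (suc-double-≤⇔ _ h (suc (toℕ x))) (ballot (suc x))))
nonNegative⇔ballotFrom {suc m} h (false ∷ S) = mk⇔
  (λ nn → λ { zero → z≤n ; (suc x) → subst (2c x ≤_) (sym (+-suc h (suc (toℕ x)))) (Equivalence.to (nonNegative⇔ballotFrom (suc h) S) nn x) })
  (λ ballot → Equivalence.from (nonNegative⇔ballotFrom (suc h) S) (λ x → subst (2c x ≤_) (+-suc h (suc (toℕ x))) (ballot (suc x))))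
  where
  2c : Fin m → ℕ
  2c x = countUpTo (lookup S) x + countUpTo (lookup S) x

dyck-replicate-D : ∀ h → DyckFrom h (replicate h D)
dyck-replicate-D zero = refl
dyck-replicate-D (suc h) = dyck-replicate-D h

nonNegative⇒completable : ∀ {m} h (w : Vec Step m) → NonNegativeFrom h w → ∃ λ v → DyckFrom h (toList w ++ v)
nonNegative⇒completable h [] _ = replicate h D , dyck-replicate-D h
nonNegative⇒completable h (U ∷ w) nn = nonNegative⇒completable (suc h) w nn
nonNegative⇒completable (suc h) (D ∷ w) nn = nonNegative⇒completable h w nn

dyckPrefix⇒nonNegative : ∀ {m} h (w : Vec Step m) v → DyckFrom h (toList w ++ v) → NonNegativeFrom h w
dyckPrefix⇒nonNegative h [] v _ = tt
dyckPrefix⇒nonNegative h (U ∷ w) v d = dyckPrefix⇒nonNegative (suc h) w v d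
dyckPrefix⇒nonNegative (suc h) (D ∷ w) v d = dyckPrefix⇒nonNegative h w v d

leftFactor⇔nonNegative : ∀ {m} (w : Vec Step m) → IsLeftFactor (toList w) ⇔ NonNegativeFrom 0 w
leftFactor⇔nonNegative w = mk⇔ (λ (v , d) → dyckPrefix⇒nonNegative 0 w v d) (nonNegative⇒completable 0 w)

inP⇔leftFactor : ∀ {m} (S : Vec Bool m) → InP (suc m) (false ∷ S) ⇔ IsLeftFactor (toList (map toStep S))
inP⇔leftFactor S = ⇔-trans (inP⇔ballot (false ∷ S)) (⇔-trans (Ballot-false∷⇔ S)
  (⇔-trans (⇔-sym (nonNegative⇔ballotFrom 0 S)) (⇔-sym (leftFactor⇔nonNegative (map toStep S)))))

faces↔leftFactors : ∀ m k → PFace (suc m) k ↔ LFactor m k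
faces↔leftFactors m k = Refinement↔ (λ S → map toStep (tail S)) (λ w → false ∷ map fromStep w) to from
  (λ { {true ∷ S} p → ⊥-elim (head-false (proj₁ p)) ; {false ∷ S} _ → cong (false ∷_) (map-fromStep-toStep S) })
  map-toStep-fromStep
  where
  head-false : ∀ {S} → InP (suc m) (true ∷ S) → ⊥
  head-false inP = contradiction (Ballot-head (Equivalence.to (inP⇔ballot _) inP)) λ ()

  to : ∀ {S} → InP (suc m) S × ∣ S ∣ ≡ k →
    IsLeftFactor (toList (map toStep (tail S))) × numD (toList (map toStep (tail S))) ≡ k
  to {true ∷ S} (inP , _) = ⊥-elim (head-false inP)
  to {false ∷ S} (inP , size) = Equivalence.to (inP⇔leftFactor S) inP , trans (numD-map-toStep S) size

  from : ∀ {w} → IsLeftFactor (toList w) × numD (toList w) ≡ k → InP (suc m) (false ∷ map fromStep w) × ∣ map fromStep w ∣ ≡ k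
  from {w} (lf , #D) =
    Equivalence.from (inP⇔leftFactor (map fromStep w)) (subst (IsLeftFactor ∘ toList) (sym (map-toStep-fromStep w)) lf) ,
    trans (∣map-fromStep∣ w) #D

-- Counting left factors

Paths : ℕ → ℕ → ℕ → Set
Paths h m j = Refinement (Vec Step m) (λ w → NonNegativeFrom h w × numD (toList w) ≡ j)

DownFirstPaths : ℕ → ℕ → ℕ → Set
DownFirstPaths zero m j = ⊥
DownFirstPaths (suc h) m zero = ⊥
DownFirstPaths (suc h) m (suc j) = Paths h m j

pathCount : ℕ → ℕ → ℕ → ℕ
downFirstCount : ℕ → ℕ → ℕ → ℕ
pathCount zero h zero = 1
pathCount zero h (suc j) = 0
pathCount (suc m) h j = pathCount m (suc h) j + downFirstCount h m j
downFirstCount zero m j = 0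
downFirstCount (suc h) m zero = 0
downFirstCount (suc h) m (suc j) = pathCount m h j

Paths-split : ∀ h m j → Paths h (suc m) j ↔ (Paths (suc h) m j ⊎ DownFirstPaths h m j)
Paths-split h m j = mk↔ₛ′ split join split∘join join∘split
  where
  split : ∀ {h j} → Paths h (suc m) j → Paths (suc h) m j ⊎ DownFirstPaths h m j
  split (U ∷ w , [ p ]) = inj₁ (w , [ p ])
  split {zero} (D ∷ w , [ p ]) = ⊥-elim (proj₁ p)
  split {suc h} {zero} (D ∷ w , [ p ]) = ⊥-elim (0≢1+n (sym (proj₂ p)))
  split {suc h} {suc j} (D ∷ w , [ p ]) = inj₂ (w , [ proj₁ p , suc-injective (proj₂ p) ])

  join : ∀ {h j} → Paths (suc h) m j ⊎ DownFirstPaths h m j → Paths h (suc m) j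
  join (inj₁ (w , [ p ])) = U ∷ w , [ p ]
  join {suc h} {suc j} (inj₂ (w , [ p ])) = D ∷ w , [ proj₁ p , cong suc (proj₂ p) ]

  split∘join : ∀ {h j} (x : Paths (suc h) m j ⊎ DownFirstPaths h m j) → split (join x) ≡ x
  split∘join (inj₁ _) = refl
  split∘join {suc h} {suc j} (inj₂ _) = refl

  join∘split : ∀ {h j} (x : Paths h (suc m) j) → join (split x) ≡ x
  join∘split (U ∷ w , _) = refl
  join∘split {zero} (D ∷ w , [ p ]) = ⊥-elim (proj₁ p)
  join∘split {suc h} {zero} (D ∷ w , [ p ]) = ⊥-elim (0≢1+n (sym (proj₂ p)))
  join∘split {suc h} {suc j} (D ∷ w , _) = refl

Paths↔pathCount : ∀ m h j → Paths h m j ↔ Fin (pathCount m h j)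
DownFirstPaths↔downFirstCount : ∀ h m j → DownFirstPaths h m j ↔ Fin (downFirstCount h m j)
Paths↔pathCount zero h zero = mk↔ₛ′ (λ _ → zero) (λ _ → [] , [ tt , refl ]) (λ { zero → refl }) (λ { ([] , _) → refl })
Paths↔pathCount zero h (suc j) = mk↔ₛ′ (λ { ([] , [ p ]) → ⊥-elim (0≢1+n (proj₂ p)) }) (λ ()) (λ ()) (λ { ([] , [ p ]) → ⊥-elim (0≢1+n (proj₂ p)) })
Paths↔pathCount (suc m) h j =
  ↔-trans (Paths-split h m j) (↔-trans (Paths↔pathCount m (suc h) j ⊎-↔ DownFirstPaths↔downFirstCount h m j) (↔-sym +↔⊎))
DownFirstPaths↔downFirstCount zero m j = ↔-sym 0↔⊥
DownFirstPaths↔downFirstCount (suc h) m zero = ↔-sym 0↔⊥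
DownFirstPaths↔downFirstCount (suc h) m (suc j) = Paths↔pathCount m h j

pathCount-zero : ∀ m h → pathCount m h 0 ≡ 1
pathCount-zero zero h = refl
pathCount-zero (suc m) zero = trans (+-identityʳ _) (pathCount-zero m 1)
pathCount-zero (suc m) (suc h) = trans (+-identityʳ _) (pathCount-zero m (suc (suc h)))

-- Reflection principle: as long as they end at height ≥ −1, the sequences from height h with j down-steps
-- that do go below 0 are counted by m C (j ∸ h ∸ 1) if j > h, and by 0 otherwise.
crossingCount : ℕ → ℕ → ℕ → ℕ
crossingCount m h zero = 0
crossingCount m zero (suc j) = m C j
crossingCount m (suc h) (suc j) = crossingCount m h j

crossingCount-≤ : ∀ m {h j} → j ≤ h → crossingCount m h j ≡ 0
crossingCount-≤ m {j = zero} z≤n = refl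
crossingCount-≤ m (s≤s j≤h) = crossingCount-≤ m j≤h

crossingCount-pascal : ∀ m h j → crossingCount (suc m) h j ≡ crossingCount m (suc h) j + crossingCount m h j
crossingCount-pascal m h zero = refl
crossingCount-pascal m zero (suc zero) = refl
crossingCount-pascal m zero (suc (suc j)) = sym (nCk+nC[k+1]≡[n+1]C[k+1] m j)
crossingCount-pascal m (suc h) (suc j) = crossingCount-pascal m h j

suc-C-pascal : ∀ m j → suc m C j ≡ m C j + crossingCount m 0 j
suc-C-pascal m zero = refl
suc-C-pascal m (suc j) = trans (sym (nCk+nC[k+1]≡[n+1]C[k+1] m j)) (+-comm (m C j) (m C suc j))

pathCount+crossingCount≡C : ∀ m h j → j + j ≤ suc (m + h) → pathCount m h j + crossingCount m h j ≡ m C j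
pathCount+crossingCount≡C zero h zero _ = refl
pathCount+crossingCount≡C zero h (suc j) 2j≤1+h = crossingCount-≤ 0 (≤-trans (s≤s (m≤n+m j j)) (subst (_≤ h) (+-suc j j) (s≤s⁻¹ 2j≤1+h)))
pathCount+crossingCount≡C (suc m) h j 2j≤2+m+h = begin
  pathCount m (suc h) j + downFirstCount h m j + crossingCount (suc m) h j
    ≡⟨ cong (pathCount m (suc h) j + downFirstCount h m j +_) (crossingCount-pascal m h j) ⟩
  pathCount m (suc h) j + downFirstCount h m j + (crossingCount m (suc h) j + crossingCount m h j)
    ≡⟨ interchange (pathCount m (suc h) j) _ _ _ ⟩
  (pathCount m (suc h) j + crossingCount m (suc h) j) + (downFirstCount h m j + crossingCount m h j)
    ≡⟨ cong₂ _+_ (pathCount+crossingCount≡C m (suc h) j (subst (j + j ≤_) (cong suc (sym (+-suc m h))) 2j≤2+m+h))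
                 (downFirst+crossing h j 2j≤2+m+h) ⟩
  m C j + crossingCount m 0 j
    ≡⟨ suc-C-pascal m j ⟨
  suc m C j ∎
  where
  open ≡-Reasoning
  interchange : ∀ a b c d → a + b + (c + d) ≡ (a + c) + (b + d)
  interchange = solve-∀
  downFirst+crossing : ∀ h j → j + j ≤ suc (suc m + h) → downFirstCount h m j + crossingCount m h j ≡ crossingCount m 0 j
  downFirst+crossing zero j _ = refl
  downFirst+crossing (suc h) zero _ = refl
  downFirst+crossing (suc h) (suc j) 2j≤ = pathCount+crossingCount≡C m h j
    (s≤s⁻¹ (subst₂ _≤_ (+-suc j j) (cong suc (+-suc m h)) (s≤s⁻¹ 2j≤)))

LFactor↔Paths : ∀ m k → LFactor m k ↔ Paths 0 m k
LFactor↔Paths m k = Refinement↔ (λ w → w) (λ w → w)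
  (λ {w} (lf , #D) → Equivalence.to (leftFactor⇔nonNegative w) lf , #D)
  (λ {w} (nn , #D) → Equivalence.from (leftFactor⇔nonNegative w) nn , #D)
  (λ _ → refl) (λ _ → refl)

faces↔pathCount : ∀ m k → PFace (suc m) k ↔ Fin (pathCount m 0 k)
faces↔pathCount m k = ↔-trans (faces↔leftFactors m k) (↔-trans (LFactor↔Paths m k) (Paths↔pathCount m 0 k))

[k+1]*[n+1]C[k+1]≡[n+1]*nCk : ∀ n k → suc k * (suc n C suc k) ≡ suc n * (n C k)
[k+1]*[n+1]C[k+1]≡[n+1]*nCk zero zero = refl
[k+1]*[n+1]C[k+1]≡[n+1]*nCk zero (suc k) = *-zeroʳ (suc (suc k))
[k+1]*[n+1]C[k+1]≡[n+1]*nCk (suc n) zero = trans (+-identityʳ _) (trans (nC1≡n (suc (suc n))) (sym (*-identityʳ _)))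
[k+1]*[n+1]C[k+1]≡[n+1]*nCk (suc n) (suc k) = begin
  suc (suc k) * (suc (suc n) C suc (suc k))
    ≡⟨ cong (suc (suc k) *_) (nCk+nC[k+1]≡[n+1]C[k+1] (suc n) (suc k)) ⟨
  suc (suc k) * (suc n C suc k + suc n C suc (suc k))
    ≡⟨ regroup (suc k) (suc n C suc k) (suc n C suc (suc k)) ⟩
  suc n C suc k + (suc k * (suc n C suc k) + suc (suc k) * (suc n C suc (suc k)))
    ≡⟨ cong (suc n C suc k +_) (cong₂ _+_ ([k+1]*[n+1]C[k+1]≡[n+1]*nCk n k) ([k+1]*[n+1]C[k+1]≡[n+1]*nCk n (suc k))) ⟩
  suc n C suc k + (suc n * (n C k) + suc n * (n C suc k))
    ≡⟨ cong (suc n C suc k +_) (*-distribˡ-+ (suc n) (n C k) (n C suc k)) ⟨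
  suc n C suc k + suc n * (n C k + n C suc k)
    ≡⟨ cong (λ t → suc n C suc k + suc n * t) (nCk+nC[k+1]≡[n+1]C[k+1] n k) ⟩
  suc (suc n) * (suc n C suc k) ∎
  where
  open ≡-Reasoning
  regroup : ∀ k a b → suc k * (a + b) ≡ a + (k * a + suc k * b)
  regroup = solve-∀

[k+1]*nC[k+1]≡[n∸k]*nCk : ∀ n k → suc k * (n C suc k) ≡ (n ∸ k) * (n C k)
[k+1]*nC[k+1]≡[n∸k]*nCk n k = begin
  suc k * (n C suc k)                                      ≡⟨ m+n∸n≡m _ (suc k * (n C k)) ⟨
  suc k * (n C suc k) + suc k * (n C k) ∸ suc k * (n C k)  ≡⟨ cong (_∸ suc k * (n C k)) pascal ⟩
  suc k * (suc n C suc k) ∸ suc k * (n C k)                ≡⟨ cong (_∸ suc k * (n C k)) ([k+1]*[n+1]C[k+1]≡[n+1]*nCk n k) ⟩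
  suc n * (n C k) ∸ suc k * (n C k)                        ≡⟨ *-distribʳ-∸ (n C k) (suc n) (suc k) ⟨
  (n ∸ k) * (n C k)                                        ∎
  where
  open ≡-Reasoning
  pascal : suc k * (n C suc k) + suc k * (n C k) ≡ suc k * (suc n C suc k)
  pascal = trans (sym (*-distribˡ-+ (suc k) (n C suc k) (n C k)))
                 (cong (suc k *_) (trans (+-comm (n C suc k) (n C k)) (nCk+nC[k+1]≡[n+1]C[k+1] n k)))

[[n+1]∸2[k+1]]*nCk/[k+1]≡nC[k+1]∸nCk : ∀ n k → ((suc n ∸ 2 * suc k) * (n C k)) / suc k ≡ n C suc k ∸ n C k
[[n+1]∸2[k+1]]*nCk/[k+1]≡nC[k+1]∸nCk n k = begin
  ((suc n ∸ 2 * suc k) * (n C k)) / suc k    ≡⟨ cong (_/ suc k) numerator ⟩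
  ((n C suc k ∸ n C k) * suc k) / suc k      ≡⟨ m*n/n≡m (n C suc k ∸ n C k) (suc k) ⟩
  n C suc k ∸ n C k                          ∎
  where
  open ≡-Reasoning
  numerator : (suc n ∸ 2 * suc k) * (n C k) ≡ (n C suc k ∸ n C k) * suc k
  numerator = begin
    (suc n ∸ 2 * suc k) * (n C k)              ≡⟨ cong (λ t → (n ∸ (k + suc t)) * (n C k)) (+-identityʳ k) ⟩
    (n ∸ (k + suc k)) * (n C k)                ≡⟨ cong (_* (n C k)) (∸-+-assoc n k (suc k)) ⟨
    (n ∸ k ∸ suc k) * (n C k)                  ≡⟨ *-distribʳ-∸ (n C k) (n ∸ k) (suc k) ⟩
    (n ∸ k) * (n C k) ∸ suc k * (n C k)        ≡⟨ cong (_∸ suc k * (n C k)) ([k+1]*nC[k+1]≡[n∸k]*nCk n k) ⟨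
    suc k * (n C suc k) ∸ suc k * (n C k)      ≡⟨ *-distribˡ-∸ (suc k) (n C suc k) (n C k) ⟨
    suc k * (n C suc k ∸ n C k)                ≡⟨ *-comm (suc k) _ ⟩
    (n C suc k ∸ n C k) * suc k                ∎

pathCount-from-0 : ∀ m i → suc i + suc i ≤ suc m → pathCount m 0 (suc i) ≡ m C suc i ∸ m C i
pathCount-from-0 m i 2i+2≤m+1 = trans (sym (m+n∸n≡m (pathCount m 0 (suc i)) (m C i)))
  (cong (_∸ m C i) (pathCount+crossingCount≡C m 0 (suc i) (subst (suc i + suc i ≤_) (cong suc (sym (+-identityʳ m))) 2i+2≤m+1)))

k≤n/2⇒k+k≤n : ∀ {k n} → k ≤ n / 2 → k + k ≤ n
k≤n/2⇒k+k≤n {k} {n} k≤n/2 = subst (_≤ n) (*2≡+ k) (≤-trans (*-monoˡ-≤ 2 k≤n/2) (m/n*n≤m n 2))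
  where
  *2≡+ : ∀ k → k * 2 ≡ k + k
  *2≡+ = solve-∀

corollary3p1 : (n : ℕ) → 3 ≤ n → (k : ℕ) → k ≤ (n ∸ 1) / 2 →
    (PFace n k ⤖ LFactor (n ∸ 1) k) ×
    ((k ≡ 0 → PFace n k ⤖ Fin 1) ×
     ((i : ℕ) → k ≡ suc i → PFace n k ⤖ Fin (((n ∸ 2 * suc i) * ((n ∸ 1) C i)) / suc i)))
corollary3p1 zero () _ _
corollary3p1 (suc m) _ k k≤m/2 =
  ↔⇒⤖ (faces↔leftFactors m k) ,
  (λ { refl → subst (λ c → PFace (suc m) 0 ⤖ Fin c) (pathCount-zero m 0) (↔⇒⤖ (faces↔pathCount m 0)) }) ,
  (λ { i refl → subst (λ c → PFace (suc m) (suc i) ⤖ Fin c)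
      (trans (pathCount-from-0 m i (m≤n⇒m≤1+n (k≤n/2⇒k+k≤n k≤m/2))) (sym ([[n+1]∸2[k+1]]*nCk/[k+1]≡nC[k+1]∸nCk m i)))
      (↔⇒⤖ (faces↔pathCount m (suc i))) })
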